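{- Let $\mathbf{T}=(\mathbf{T}(N))_{N\ge 0}$ be defined by $\mathbf{T}(N)=s_{3/2}(N) \bmod 2$, where $s_{3/2}(N)$ is the sum of the digits of the base $3/2$ representation of $N$. Then $\mathbf{T}$ is a fixed point of the $2$-$3$-block substitution $\kappa$ on $\{0,1\}$ given by $$00\mapsto 010,\quad 01\mapsto 010,\quad 10\mapsto 101,\quad 11\mapsto 101,$$ i.e., $\kappa(\mathbf{T})=\mathbf{T}$.
   Context: Every natural number $N$ can be written uniquely (ignoring leading zeros) as $N=\sum_{i=0}^{R} d_i (3/2)^i$ with digits $d_i\in\{0,1,2\}$; this is the base $3/2$ representation of $N$, and $s_{3/2}(N)=\sum_{i=0}^R d_i$ (with $s_{3/2}(0)=0$). A $2$-$3$-block substitution $\kappa$ on an alphabet $A$ assigns to each word $ab$ of length 2 over $A$ a word $\kappa(ab)$ of length 3; it acts on an infinite sequence $x=x_0x_1x_2\dots$ by $\kappa(x)=y$ where $y_{3k}y_{3k+1}y_{3k+2}=\kappa(x_{2k}x_{2k+1})$ for $k=0,1,2,\dots$. A fixed point of $\kappa$ is a sequence $x$ with $\kappa(x)=x$. -}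

module Defs where

open import Data.Nat using (ℕ; zero; suc; _+_; _*_)
open import Data.Nat.DivMod using (_/_; _%_; _mod_)
open import Data.List using (List; []; _∷_)
open import Data.Nat.ListAction using (sum)
open import Data.Fin using (Fin; zero; suc)
open import Data.Vec using (Vec; []; _∷_; lookup)

-- Base 3/2 digits of N, least significant first: N = Σ d_i (3/2)^i, d_i ∈ {0,1,2}.
-- Since N = d₀ + (3/2)·M with M = Σ d_{i+1} (3/2)^i forced to be an integer,
-- d₀ = N mod 3 and M = 2·(N div 3).  The fuel argument only guarantees termination
-- (the number N strictly decreases at each step while N ≥ 1, so fuel N suffices).
digitsFuel : ℕ → ℕ → List ℕ
digitsFuel zero    _       = []
digitsFuel (suc f) zero    = []
digitsFuel (suc f) (suc n) = (suc n % 3) ∷ digitsFuel f (2 * (suc n / 3))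

digits32 : ℕ → List ℕ
digits32 n = digitsFuel n n

s32 : ℕ → ℕ
s32 n = sum (digits32 n)

T : ℕ → Fin 2
T n = s32 n mod 2

BlockSubst23 : Set → Set
BlockSubst23 A = A → A → Vec A 3

apply23 : {A : Set} → BlockSubst23 A → (ℕ → A) → (ℕ → A)
apply23 κ x n = lookup (κ (x (2 * (n / 3))) (x (suc (2 * (n / 3))))) (n mod 3)

κ : BlockSubst23 (Fin 2)
κ zero       zero       = zero ∷ suc zero ∷ zero ∷ []
κ zero       (suc zero) = zero ∷ suc zero ∷ zero ∷ []
κ (suc zero) zero       = suc zero ∷ zero ∷ suc zero ∷ []
κ (suc zero) (suc zero) = suc zero ∷ zero ∷ suc zero ∷ []

-- The base 3/2 expansion of N is that of 2·⌊N/3⌋ with the digit N mod 3 prepended, so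
-- T(N) ≡ (N mod 3) + T(2⌊N/3⌋) (mod 2).  For N = 3k + j this says that the block
-- T(3k) T(3k+1) T(3k+2) is a, a+1, a with a = T(2k): exactly κ(T(2k) T(2k+1)), which
-- ignores its second letter.
module Submission where

open import Defs
open import Data.Nat using (ℕ; zero; suc; _+_; _*_; _≤_; _<_; z≤n; NonZero)
open import Data.Nat.Properties using (≤-refl; ≤-trans; ≤-pred; *-comm; *-monoˡ-<)
open import Data.Nat.DivMod using (_/_; _%_; _mod_; m%n<n; m/n*n≤m; m%n%n≡m%n; %-distribˡ-+)
open import Data.Nat.ListAction using (sum)
open import Data.Fin using (Fin; toℕ) renaming (zero to fz; suc to fs)
open import Data.Fin.Properties using (toℕ-fromℕ<; toℕ-injective)
open import Data.Vec using (lookup)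
open import Data.List using (_∷_)
open import Relation.Binary.PropositionalEquality using (_≡_; refl; sym; cong; subst; module ≡-Reasoning)

toℕ-mod : ∀ m n .{{_ : NonZero n}} → toℕ (m mod n) ≡ m % n
toℕ-mod m n = toℕ-fromℕ< (m%n<n m n)

[m+n%d]%d≡[m+n]%d : ∀ m n d .{{_ : NonZero d}} → (m + n % d) % d ≡ (m + n) % d
[m+n%d]%d≡[m+n]%d m n d = begin
  (m + n % d) % d           ≡⟨ %-distribˡ-+ m (n % d) d ⟩
  (m % d + n % d % d) % d   ≡⟨ cong (λ k → (m % d + k) % d) (m%n%n≡m%n n d) ⟩
  (m % d + n % d) % d       ≡⟨ %-distribˡ-+ m n d ⟨
  (m + n) % d               ∎
  where open ≡-Reasoning

2*[1+n]/3≤n : ∀ n → 2 * (suc n / 3) ≤ n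
2*[1+n]/3≤n n with suc n / 3 in eq
... | zero  = z≤n
... | suc k = ≤-pred (≤-trans 2*[1+k]<[1+k]*3 (subst (_≤ suc n) (cong (_* 3) eq) (m/n*n≤m (suc n) 3)))
  where
  2*[1+k]<[1+k]*3 : 2 * suc k < suc k * 3
  2*[1+k]<[1+k]*3 = subst (2 * suc k <_) (*-comm 3 (suc k)) (*-monoˡ-< (suc k) {2} {3} ≤-refl)

digitsFuel-fuel-irrelevant : ∀ f g n → n ≤ f → n ≤ g → digitsFuel f n ≡ digitsFuel g n
digitsFuel-fuel-irrelevant zero    zero    n       _   _   = refl
digitsFuel-fuel-irrelevant zero    (suc g) zero    _   _   = refl
digitsFuel-fuel-irrelevant (suc f) zero    zero    _   _   = refl
digitsFuel-fuel-irrelevant (suc f) (suc g) zero    _   _   = refl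
digitsFuel-fuel-irrelevant (suc f) (suc g) (suc n) n<f n<g =
  cong (suc n % 3 ∷_)
    (digitsFuel-fuel-irrelevant f g (2 * (suc n / 3))
      (≤-trans (2*[1+n]/3≤n n) (≤-pred n<f)) (≤-trans (2*[1+n]/3≤n n) (≤-pred n<g)))

s32-unfold : ∀ n → s32 n ≡ n % 3 + s32 (2 * (n / 3))
s32-unfold zero    = refl
s32-unfold (suc n) =
  cong (λ ds → suc n % 3 + sum ds)
    (digitsFuel-fuel-irrelevant n m m (2*[1+n]/3≤n n) ≤-refl)
  where m = 2 * (suc n / 3)

toℕ-T-unfold : ∀ n → toℕ (T n) ≡ (n % 3 + toℕ (T (2 * (n / 3)))) % 2
toℕ-T-unfold n = begin
  toℕ (T n)                           ≡⟨ toℕ-mod (s32 n) 2 ⟩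
  s32 n % 2                           ≡⟨ cong (_% 2) (s32-unfold n) ⟩
  (n % 3 + s) % 2                     ≡⟨ [m+n%d]%d≡[m+n]%d (n % 3) s 2 ⟨
  (n % 3 + s % 2) % 2                 ≡⟨ cong (λ k → (n % 3 + k) % 2) (toℕ-mod s 2) ⟨
  (n % 3 + toℕ (T (2 * (n / 3)))) % 2 ∎
  where
  open ≡-Reasoning
  s = s32 (2 * (n / 3))

toℕ-lookup-κ : ∀ (a b : Fin 2) (j : Fin 3) → toℕ (lookup (κ a b) j) ≡ (toℕ j + toℕ a) % 2
toℕ-lookup-κ fz      fz      fz           = refl
toℕ-lookup-κ fz      fz      (fs fz)      = refl
toℕ-lookup-κ fz      fz      (fs (fs fz)) = refl
toℕ-lookup-κ fz      (fs fz) fz           = refl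
toℕ-lookup-κ fz      (fs fz) (fs fz)      = refl
toℕ-lookup-κ fz      (fs fz) (fs (fs fz)) = refl
toℕ-lookup-κ (fs fz) fz      fz           = refl
toℕ-lookup-κ (fs fz) fz      (fs fz)      = refl
toℕ-lookup-κ (fs fz) fz      (fs (fs fz)) = refl
toℕ-lookup-κ (fs fz) (fs fz) fz           = refl
toℕ-lookup-κ (fs fz) (fs fz) (fs fz)      = refl
toℕ-lookup-κ (fs fz) (fs fz) (fs (fs fz)) = refl

theorem1 : (n : ℕ) → apply23 κ T n ≡ T n
theorem1 n = toℕ-injective (begin
  toℕ (apply23 κ T n)             ≡⟨ toℕ-lookup-κ (T k) (T (suc k)) (n mod 3) ⟩
  (toℕ (n mod 3) + toℕ (T k)) % 2 ≡⟨ cong (λ r → (r + toℕ (T k)) % 2) (toℕ-mod n 3) ⟩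
  (n % 3 + toℕ (T k)) % 2         ≡⟨ toℕ-T-unfold n ⟨
  toℕ (T n)                       ∎)
  where
  open ≡-Reasoning
  k = 2 * (n / 3)
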